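{- Let $n\ge1$ and let $G$ be the hypertree $HT(n)$. Then every minimum dominating set of $G$ contains at least $2^{n-1}$ vertices from levels $n-1$ and $n$.
   Context: The hypertree $HT(n)$ has vertex set $\{1,\dots,2^{n+1}-1\}$, with the complete binary tree edges $\{x,2x\},\{x,2x+1\}$ (the root $1$ is at level $0$; vertex $v$ is at level $i$ iff $2^i\le v\le 2^{i+1}-1$) plus, for each level $i\ge1$, edges between level-$i$ vertices whose labels differ by $2^{i-1}$. A dominating set is a set $S$ such that every vertex outside $S$ has a neighbor in $S$; a minimum dominating set is one of least cardinality. -}

module Defs where

open import Data.Nat using (ℕ; zero; suc; _+_; _*_; _∸_; _^_; _≤_; _<_; _≤?_; _<?_)
open import Data.Product using (_×_; Σ; ∃-syntax)
open import Data.Sum using (_⊎_)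
open import Data.List using (List; length; filter)
open import Data.List.Membership.Propositional using (_∈_)
open import Data.List.Relation.Unary.Unique.Propositional using (Unique)
open import Relation.Binary.PropositionalEquality using (_≡_)
open import Relation.Nullary using (¬_)
open import Relation.Nullary.Decidable using (_×-dec_)

IsVertex : ℕ → ℕ → Set
IsVertex n v = 1 ≤ v × v < 2 ^ suc n

AtLevel : ℕ → ℕ → Set
AtLevel i v = 2 ^ i ≤ v × v < 2 ^ suc i

TreeEdge : ℕ → ℕ → Set
TreeEdge x y = y ≡ 2 * x ⊎ y ≡ 2 * x + 1

-- horizontal edge at level i ≥ 1 (written with i = suc j, so 2^(i-1) = 2^j)
LevelEdge : ℕ → ℕ → Set
LevelEdge x y = ∃[ j ] (AtLevel (suc j) x × AtLevel (suc j) y × y ≡ x + 2 ^ j)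

Adj : ℕ → ℕ → Set
Adj x y = TreeEdge x y ⊎ TreeEdge y x ⊎ LevelEdge x y ⊎ LevelEdge y x

IsVertexSet : ℕ → List ℕ → Set
IsVertexSet n S = Unique S × (∀ v → v ∈ S → IsVertex n v)

IsDominating : ℕ → List ℕ → Set
IsDominating n S =
  IsVertexSet n S ×
  (∀ v → IsVertex n v → ¬ (v ∈ S) → ∃[ u ] (u ∈ S × Adj u v))

IsMinimumDominating : ℕ → List ℕ → Set
IsMinimumDominating n S =
  IsDominating n S × (∀ T → IsDominating n T → length S ≤ length T)

countLastTwo : ℕ → List ℕ → ℕ
countLastTwo n S = length (filter (λ v → (2 ^ (n ∸ 1) ≤? v) ×-dec (v <? 2 ^ suc n)) S)

module Submission where

-- Write n = m + 1 and N = 2^m.  The leaves of HT(n) are the 2N vertices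
-- of level n, i.e. the numbers in [2N, 4N).  A vertex u dominates a leaf v
-- (u = v or u ~ v) only if u lies in level n - 1 (then v is one of the two
-- children 2u, 2u + 1) or in level n (then v is u itself or its unique
-- horizontal neighbour u ± N).  So every vertex of levels n - 1 and n dominates
-- at most two leaves, and a set dominating all 2N leaves needs at least N such
-- vertices.

open import Defs
open import Data.Nat using (ℕ; suc; _+_; _*_; _∸_; _^_; _≤_; _<_; _≤?_; _<?_; z≤n; s≤s)
open import Data.Nat.Properties
open import Data.List using (List; []; _∷_; _++_; length; filter; map; applyUpTo)
open import Data.List.Properties using (length-++; length-map; length-applyUpTo)
open import Data.List.Membership.Propositional using (_∈_)
open import Data.List.Membership.Propositional.Properties
  using (∈-∃++; ∈-++⁻; ∈-++⁺ˡ; ∈-++⁺ʳ; ∈-map⁺; ∈-filter⁺; ∈-applyUpTo⁻)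
open import Data.List.Membership.DecPropositional _≟_ using (_∈?_)
open import Data.List.Relation.Unary.Any using (here; there)
open import Data.List.Relation.Unary.All as All using ()
open import Data.List.Relation.Unary.AllPairs using (_∷_)
open import Data.List.Relation.Unary.Unique.Propositional using (Unique)
open import Data.List.Relation.Unary.Unique.Propositional.Properties using (applyUpTo⁺₁)
open import Data.Product using (_×_; _,_; proj₁; proj₂; ∃-syntax)
open import Data.Sum using (_⊎_; inj₁; inj₂)
open import Relation.Nullary using (Dec; yes; no; contradiction)
open import Relation.Nullary.Decidable using (_×-dec_)
open import Relation.Binary.PropositionalEquality

∈-delete : ∀ {A : Set} {x y : A} xs ys → y ∈ xs ++ x ∷ ys → y ≢ x → y ∈ xs ++ ys
∈-delete xs ys y∈ y≢x with ∈-++⁻ xs y∈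
... | inj₁ y∈xs         = ∈-++⁺ˡ y∈xs
... | inj₂ (here y≡x)   = contradiction y≡x y≢x
... | inj₂ (there y∈ys) = ∈-++⁺ʳ xs y∈ys

unique-⊆-length : ∀ {A : Set} (xs ys : List A) → Unique xs →
                  (∀ {v} → v ∈ xs → v ∈ ys) → length xs ≤ length ys
unique-⊆-length []       ys _               _   = z≤n
unique-⊆-length (x ∷ xs) ys (x∉xs ∷ uniq) sub with ∈-∃++ (sub (here refl))
... | before , after , refl = begin
  suc (length xs)                      ≤⟨ s≤s (unique-⊆-length xs (before ++ after) uniq sub′) ⟩
  suc (length (before ++ after))       ≡⟨ cong suc (length-++ before) ⟩
  suc (length before + length after)   ≡⟨ +-suc (length before) (length after) ⟨
  length before + length (x ∷ after)   ≡⟨ length-++ before ⟨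
  length (before ++ x ∷ after)         ∎
  where
  open ≤-Reasoning
  sub′ : ∀ {v} → v ∈ xs → v ∈ before ++ after
  sub′ v∈xs = ∈-delete before after (sub (there v∈xs)) (λ v≡x → All.lookup x∉xs v∈xs (sym v≡x))

two-images-bound : ∀ {A B : Set} (f g : B → A) (xs : List A) (ys : List B) → Unique xs →
                   (∀ {x} → x ∈ xs → ∃[ y ] (y ∈ ys × (x ≡ f y ⊎ x ≡ g y))) →
                   length xs ≤ 2 * length ys
two-images-bound f g xs ys uniq cover = begin
  length xs                              ≤⟨ unique-⊆-length xs (map f ys ++ map g ys) uniq images ⟩
  length (map f ys ++ map g ys)          ≡⟨ length-++ (map f ys) ⟩
  length (map f ys) + length (map g ys)  ≡⟨ cong₂ _+_ (length-map f ys) (length-map g ys) ⟩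
  length ys + length ys                  ≡⟨ cong (length ys +_) (+-identityʳ (length ys)) ⟨
  2 * length ys                          ∎
  where
  open ≤-Reasoning
  images : ∀ {x} → x ∈ xs → x ∈ map f ys ++ map g ys
  images x∈xs with cover x∈xs
  ... | y , y∈ys , inj₁ refl = ∈-++⁺ˡ (∈-map⁺ f y∈ys)
  ... | y , y∈ys , inj₂ refl = ∈-++⁺ʳ (map f ys) (∈-map⁺ g y∈ys)

half-≤ : ∀ a b → 2 * a ≤ 2 * b + 1 → a ≤ b
half-≤ a b h = ≤-pred (*-cancelˡ-< 2 a (suc b) (begin-strict
  2 * a            ≤⟨ h ⟩
  2 * b + 1        <⟨ n<1+n (2 * b + 1) ⟩
  suc (2 * b + 1)  ≡⟨ cong suc (+-comm (2 * b) 1) ⟩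
  2 + 2 * b        ≡⟨ *-suc 2 b ⟨
  2 * suc b        ∎))
  where open ≤-Reasoning

level-bound : ∀ {i k v} → 2 ^ k ≤ v → v < 2 ^ suc i → k ≤ i
level-bound {i} {k} 2^k≤v v<2^i+1 with k ≤? i
... | yes k≤i = k≤i
... | no  k≰i = contradiction (≤-trans (^-monoʳ-≤ 2 (≰⇒> k≰i)) 2^k≤v) (<⇒≱ v<2^i+1)

level-unique : ∀ {i k v} → AtLevel i v → AtLevel k v → i ≡ k
level-unique (2^i≤v , v<2^i+1) (2^k≤v , v<2^k+1) =
  ≤-antisym (level-bound 2^i≤v v<2^k+1) (level-bound 2^k≤v v<2^i+1)

parent-level : ∀ {k u v} → AtLevel (suc k) v → TreeEdge u v → AtLevel k u
parent-level {k} {u} (lo , hi) (inj₁ refl) =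
  *-cancelˡ-≤ 2 lo , *-cancelˡ-< 2 u (2 ^ suc k) hi
parent-level {k} {u} (lo , hi) (inj₂ refl) =
  half-≤ (2 ^ k) u lo , *-cancelˡ-< 2 u (2 ^ suc k) (≤-<-trans (m≤m+n (2 * u) 1) hi)

child-lower-bound : ∀ {k u v} → 2 ^ k ≤ u → TreeEdge u v → 2 ^ suc k ≤ v
child-lower-bound {k} {u} 2^k≤u (inj₁ refl) = *-monoʳ-≤ 2 2^k≤u
child-lower-bound {k} {u} 2^k≤u (inj₂ refl) = ≤-trans (*-monoʳ-≤ 2 2^k≤u) (m≤m+n (2 * u) 1)

-- From here on N = 2^m, and the leaves of HT(m + 1) are the numbers in [2N, 4N).
-- 4N = 3N + N, written with the sums used by horizontalPartner.
four-times : ∀ N → 2 * (2 * N) ≡ 2 * N + N + N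
four-times N = begin
  2 * (2 * N)          ≡⟨ cong (2 * N +_) (+-identityʳ (2 * N)) ⟩
  2 * N + 2 * N        ≡⟨ cong (λ k → 2 * N + (N + k)) (+-identityʳ N) ⟩
  2 * N + (N + N)      ≡⟨ +-assoc (2 * N) N N ⟨
  2 * N + N + N        ∎
  where open ≡-Reasoning

horizontalPartner : ℕ → ℕ → ℕ
horizontalPartner N u with u <? 2 * N + N
... | yes _ = u + N
... | no  _ = u ∸ N

partner-up : ∀ {N u} → u + N < 2 * (2 * N) → horizontalPartner N u ≡ u + N
partner-up {N} {u} u+N<4N with u <? 2 * N + N
... | yes _   = refl
... | no  u≮3N =
  contradiction (+-cancelʳ-< N u (2 * N + N) (subst (u + N <_) (four-times N) u+N<4N)) u≮3N

partner-down : ∀ {N u} → 2 * N + N ≤ u → horizontalPartner N u ≡ u ∸ N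
partner-down {N} {u} 3N≤u with u <? 2 * N + N
... | yes u<3N = contradiction 3N≤u (<⇒≱ u<3N)
... | no  _    = refl

dominatedLeaf₁ : ℕ → ℕ → ℕ
dominatedLeaf₁ N u with u <? 2 * N
... | yes _ = 2 * u
... | no  _ = u

dominatedLeaf₂ : ℕ → ℕ → ℕ
dominatedLeaf₂ N u with u <? 2 * N
... | yes _ = 2 * u + 1
... | no  _ = horizontalPartner N u

DominatesLeaf : ℕ → ℕ → ℕ → Set
DominatesLeaf N u v = v ≡ dominatedLeaf₁ N u ⊎ v ≡ dominatedLeaf₂ N u

children-dominated : ∀ {N u v} → u < 2 * N → TreeEdge u v → DominatesLeaf N u v
children-dominated {N} {u} u<2N child with u <? 2 * N
... | yes _    = child
... | no u≮2N  = contradiction u<2N u≮2N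

self-dominated : ∀ {N u} → 2 * N ≤ u → DominatesLeaf N u u
self-dominated {N} {u} 2N≤u with u <? 2 * N
... | yes u<2N = contradiction 2N≤u (<⇒≱ u<2N)
... | no  _    = inj₁ refl

partner-dominated : ∀ {N u v} → 2 * N ≤ u → v ≡ horizontalPartner N u → DominatesLeaf N u v
partner-dominated {N} {u} 2N≤u v≡partner with u <? 2 * N
... | yes u<2N = contradiction 2N≤u (<⇒≱ u<2N)
... | no  _    = inj₂ v≡partner

LastTwoLevels : ℕ → ℕ → Set
LastTwoLevels m u = 2 ^ m ≤ u × u < 2 ^ suc (suc m)

top-level-in-last-two : ∀ {m u} → AtLevel (suc m) u → LastTwoLevels m u
top-level-in-last-two {m} (lo , hi) =
  ≤-trans (m≤m+n (2 ^ m) (2 ^ m + 0)) lo , hi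

leaf-neighbour : ∀ m {u v} → AtLevel (suc m) v → u < 2 ^ suc (suc m) → Adj u v →
                 LastTwoLevels m u × DominatesLeaf (2 ^ m) u v
leaf-neighbour m v-leaf u<4N (inj₁ u-parent) with parent-level {m} v-leaf u-parent
... | u-lo , u-hi = (u-lo , u<4N) , children-dominated {2 ^ m} u-hi u-parent
leaf-neighbour m (v-lo , _) u<4N (inj₂ (inj₁ u-child)) =
  contradiction (child-lower-bound {suc m} v-lo u-child) (<⇒≱ u<4N)
leaf-neighbour m {u} v-leaf _ (inj₂ (inj₂ (inj₁ (j , u-level , v-level , v≡u+N))))
  with level-unique {suc j} {suc m} v-level v-leaf
... | refl = top-level-in-last-two {m} u-level ,
             partner-dominated {2 ^ m} (proj₁ u-level) (trans v≡u+N (sym (partner-up {2 ^ m} u+N<4N)))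
  where
  u+N<4N : u + 2 ^ m < 2 ^ suc (suc m)
  u+N<4N = subst (_< 2 ^ suc (suc m)) v≡u+N (proj₂ v-leaf)
leaf-neighbour m {u} {v} v-leaf _ (inj₂ (inj₂ (inj₂ (j , v-level , u-level , u≡v+N))))
  with level-unique {suc j} {suc m} v-level v-leaf
... | refl = top-level-in-last-two {m} u-level ,
             partner-dominated {N} (proj₁ u-level) v≡partner
  where
  N : ℕ
  N = 2 ^ m
  3N≤u : 2 * N + N ≤ u
  3N≤u = subst (2 * N + N ≤_) (sym u≡v+N) (+-monoˡ-≤ N (proj₁ v-leaf))
  v≡partner : v ≡ horizontalPartner N u
  v≡partner = begin
    v                    ≡⟨ m+n∸n≡m v N ⟨
    v + N ∸ N            ≡⟨ cong (_∸ N) u≡v+N ⟨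
    u ∸ N                ≡⟨ partner-down {N} 3N≤u ⟨
    horizontalPartner N u ∎
    where open ≡-Reasoning

leaf-dominated : ∀ m {S v} → IsDominating (suc m) S → AtLevel (suc m) v →
                 ∃[ u ] (u ∈ S × LastTwoLevels m u × DominatesLeaf (2 ^ m) u v)
leaf-dominated m {S} {v} ((_ , vertices) , dominated) v-leaf@(v-lo , v-hi) with v ∈? S
... | yes v∈S = v , v∈S , top-level-in-last-two {m} v-leaf , self-dominated {2 ^ m} v-lo
... | no  v∉S with dominated v (≤-trans (m^n>0 2 (suc m)) v-lo , v-hi) v∉S
...   | u , u∈S , u~v = u , u∈S , leaf-neighbour m v-leaf (proj₂ (vertices u u∈S)) u~v

leaves : ℕ → List ℕ
leaves m = applyUpTo (2 ^ suc m +_) (2 ^ suc m)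

leaves-unique : ∀ m → Unique (leaves m)
leaves-unique m = applyUpTo⁺₁ (2 ^ suc m +_) (2 ^ suc m)
  (λ i<j _ same → <⇒≢ i<j (+-cancelˡ-≡ (2 ^ suc m) _ _ same))

leaves-at-level : ∀ m {v} → v ∈ leaves m → AtLevel (suc m) v
leaves-at-level m v∈leaves with ∈-applyUpTo⁻ (2 ^ suc m +_) v∈leaves
... | i , i<L , refl = m≤m+n L i , +-monoʳ-< L (<-≤-trans i<L (m≤m+n L 0))
  where
  L : ℕ
  L = 2 ^ suc m

dominating-set-bound : ∀ m S → IsDominating (suc m) S → 2 ^ m ≤ countLastTwo (suc m) S
dominating-set-bound m S dominating = *-cancelˡ-≤ 2 (begin
  2 * 2 ^ m          ≡⟨ length-applyUpTo (2 ^ suc m +_) (2 ^ suc m) ⟨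
  length (leaves m)  ≤⟨ two-images-bound (dominatedLeaf₁ N) (dominatedLeaf₂ N) (leaves m) S′
                          (leaves-unique m) cover ⟩
  2 * length S′      ∎)
  where
  open ≤-Reasoning
  N : ℕ
  N = 2 ^ m
  inLastTwo? : ∀ v → Dec (LastTwoLevels m v)
  inLastTwo? v = (2 ^ m ≤? v) ×-dec (v <? 2 ^ suc (suc m))
  S′ : List ℕ
  S′ = filter inLastTwo? S
  cover : ∀ {v} → v ∈ leaves m → ∃[ u ] (u ∈ S′ × DominatesLeaf N u v)
  cover v∈leaves with leaf-dominated m dominating (leaves-at-level m v∈leaves)
  ... | u , u∈S , in-last-two , dominates = u , ∈-filter⁺ inLastTwo? u∈S in-last-two , dominates

lemma4 : (n : ℕ) → 1 ≤ n → (S : List ℕ) → IsMinimumDominating n S →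
    2 ^ (n ∸ 1) ≤ countLastTwo n S
lemma4 (suc m) _ S (dominating , _) = dominating-set-bound m S dominating
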